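{- $\bigcap_{k=0}^{+\infty}\mathbb P_k=\emptyset$, where $\mathbb P_k=\{p^{(k)}_n:n\in\mathbb N\}$.
   Context: Let $p_n$ denote the $n$-th prime number ($p_1=2$). Define $p^{(0)}_n=n$ and recursively $p^{(k+1)}_n=p_{p^{(k)}_n}$ for $k\in\mathbb N_0$. -}

module Defs where

open import Data.Nat using (ℕ; zero; suc; _+_; _≤_)
open import Data.Nat.Primality using (Prime; prime?)
open import Data.Product using (Σ; ∃; _×_)
open import Relation.Nullary.Decidable using (does)
open import Data.Bool using (if_then_else_)
open import Relation.Binary.PropositionalEquality using (_≡_)

primeCount : ℕ → ℕ
primeCount zero    = zero
primeCount (suc m) = (if does (prime? m) then 1 else 0) + primeCount m

-- NthPrime n p : p is the n-th prime p_n (p_1 = 2), i.e. p is prime and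
-- exactly n - 1 primes lie below p.
NthPrime : ℕ → ℕ → Set
NthPrime n p = Prime p × suc (primeCount p) ≡ n

-- IterPrime k n m : m = p^{(k)}_n   (p^{(0)}_n = n, p^{(k+1)}_n = p_{p^{(k)}_n})
data IterPrime : ℕ → ℕ → ℕ → Set where
  iter-zero : ∀ {n} → IterPrime zero n n
  iter-suc  : ∀ {k n j m} → IterPrime k n j → NthPrime j m → IterPrime (suc k) n m

-- ℙ_k = { p^{(k)}_n : n ∈ ℕ },  ℕ = {1, 2, ...}
InPk : ℕ → ℕ → Set
InPk k m = Σ ℕ (λ n → 1 ≤ n × IterPrime k n m)

{-# OPTIONS --safe #-}
module Submission where

-- p_j > j for every j, so p^{(k)}_n ≥ k + n. Hence an element
-- m of ℙ_{m+1} would satisfy m ≥ m + 1 + n for some n, which is absurd.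

open import Defs
open import Data.Nat using (ℕ; zero; suc; _+_; _≤_; _<_; z≤n; s≤s)
open import Data.Nat.Properties using (+-mono-≤; ≤-refl; ≤-trans; m≤m+n; n≮n)
open import Data.Nat.Primality using (prime?)
open import Data.Bool using (Bool; true; false; if_then_else_)
open import Relation.Nullary using (¬_)
open import Relation.Nullary.Decidable using (does)
open import Data.Product using (_,_)
open import Relation.Binary.PropositionalEquality using (refl)

indicator≤1 : (b : Bool) → (if b then 1 else 0) ≤ 1
indicator≤1 true  = s≤s z≤n
indicator≤1 false = z≤n

-- 0 and 1 are not prime, so at most m of the numbers below m + 2 are.
primeCount-2+m≤m : ∀ m → primeCount (suc (suc m)) ≤ m
primeCount-2+m≤m zero    = z≤n
primeCount-2+m≤m (suc m) =
  +-mono-≤ (indicator≤1 (does (prime? (suc (suc m))))) (primeCount-2+m≤m m)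

nthPrime-index< : ∀ {j p} → NthPrime j p → j < p
nthPrime-index< {p = suc (suc m)} (_ , refl) = s≤s (s≤s (primeCount-2+m≤m m))

iterPrime-lowerBound : ∀ {k n m} → IterPrime k n m → k + n ≤ m
iterPrime-lowerBound iter-zero                    = ≤-refl
iterPrime-lowerBound (iter-suc iterated nthPrime) =
  ≤-trans (s≤s (iterPrime-lowerBound iterated)) (nthPrime-index< nthPrime)

corollary2 : (m : ℕ) → ¬ ((k : ℕ) → InPk k m)
corollary2 m inAll with inAll (suc m)
... | n , _ , iterated =
  n≮n m (≤-trans (s≤s (m≤m+n m n)) (iterPrime-lowerBound iterated))
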